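{- Let $F$ be a poset and $n\in\mathbb{N}$. Then $F$ validates $\mathbf{PL}_n$ if and only if the following hold: (i) $F$ has height at most $n$; (ii) whenever $\mathrm{depth}(x)=1$, we have $|{\Uparrow}x|\le 2$; (iii) whenever $\mathrm{depth}(x)>1$, the set ${\Uparrow}x$ is connected.
   Context: Formulas are those of intuitionistic propositional logic; an intermediate logic is a set of formulas containing $\mathbf{IPC}$ and closed under modus ponens and substitution. Kripke frames are posets with the usual intuitionistic validity. The height of a poset is the supremum in $\mathbb{N}\cup\{\infty\}$ of $|X|-1$ over chains $X$. For $x\in F$: ${\uparrow}x=\{y\mid y\ge x\}$, ${\Uparrow}x=\{y\mid y>x\}$, and $\mathrm{depth}(x)$ is the height of ${\uparrow}x$. Connectedness of a subset refers to the Alexandrov topology (open sets = upward-closed sets) restricted to that subset. $\mathbf{BD}_n$ is the logic of all finite posets of height at most $n$. A p-morphism $f\colon F\to G$ satisfies $f({\uparrow}x)={\uparrow}f(x)$. For a finite rooted poset $Q$, $\chi(Q)$ is its Jankov–Fine formula: a frame $F$ validates $\chi(Q)$ iff there is no surjective p-morphism from an upward-closed subset of $F$ onto $Q$. $\mathrm{Fork}_3$ is a root with three pairwise incomparable elements above it; $\mathrm{Scott}$ is $\{r,a,b,c\}$ with $r<a<b$, $r<c$, $c$ incomparable with $a,b$. $\mathbf{PL}$ is the smallest intermediate logic containing $\chi(\mathrm{Fork}_3)$ and $\chi(\mathrm{Scott})$; $\mathbf{PL}_n$ is the smallest intermediate logic containing $\mathbf{BD}_n\cup\mathbf{PL}$.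 -}

module Defs where

open import Level using (Level; _⊔_; 0ℓ; Lift) renaming (suc to lsuc)
open import Data.Nat using (ℕ; zero; suc; _+_; _*_) renaming (_≤_ to _≤ℕ_)
open import Data.Bool using (Bool; true; false; _∧_; _∨_; not; if_then_else_)
open import Data.Fin using (Fin; zero; suc; inject₁; _≟_)
open import Data.List using (List; []; _∷_; concatMap; filterᵇ)
open import Data.Bool.ListAction using (all)
open import Data.List using () renaming (allFin to allFinL)
open import Data.Product using (Σ; ∃; _×_; _,_)
open import Data.Sum using (_⊎_)
open import Data.Empty using (⊥)
open import Relation.Nullary using (¬_; Dec)
open import Relation.Nullary.Decidable using (⌊_⌋)
open import Relation.Binary.PropositionalEquality using (_≡_)
open import Relation.Binary.Bundles using (Poset)

infixr 6 _∧'_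
infixr 5 _∨'_
infixr 4 _⇒_

data Formula : Set where
  var  : ℕ → Formula
  ⊥'   : Formula
  _∧'_ : Formula → Formula → Formula
  _∨'_ : Formula → Formula → Formula
  _⇒_  : Formula → Formula → Formula

⊤' : Formula
⊤' = ⊥' ⇒ ⊥'

_⇔'_ : Formula → Formula → Formula
φ ⇔' ψ = (φ ⇒ ψ) ∧' (ψ ⇒ φ)

⋀ : List Formula → Formula
⋀ []       = ⊤'
⋀ (φ ∷ φs) = φ ∧' ⋀ φs

_[_] : Formula → (ℕ → Formula) → Formula
var i    [ σ ] = σ i
⊥'       [ σ ] = ⊥'
(φ ∧' ψ) [ σ ] = (φ [ σ ]) ∧' (ψ [ σ ])
(φ ∨' ψ) [ σ ] = (φ [ σ ]) ∨' (ψ [ σ ])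
(φ ⇒ ψ)  [ σ ] = (φ [ σ ]) ⇒ (ψ [ σ ])

-- IPC is given by the standard Hilbert axioms
-- (as formulas in the variables p = 0, q = 1, r = 2); together with
-- closure under modus ponens and substitution they generate IPC.

data IPCAxiom : Formula → Set where
  K    : IPCAxiom (var 0 ⇒ var 1 ⇒ var 0)
  S    : IPCAxiom ((var 0 ⇒ var 1 ⇒ var 2) ⇒ (var 0 ⇒ var 1) ⇒ var 0 ⇒ var 2)
  ∧E₁  : IPCAxiom (var 0 ∧' var 1 ⇒ var 0)
  ∧E₂  : IPCAxiom (var 0 ∧' var 1 ⇒ var 1)
  ∧I   : IPCAxiom (var 0 ⇒ var 1 ⇒ var 0 ∧' var 1)
  ∨I₁  : IPCAxiom (var 0 ⇒ var 0 ∨' var 1)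
  ∨I₂  : IPCAxiom (var 1 ⇒ var 0 ∨' var 1)
  ∨E   : IPCAxiom ((var 0 ⇒ var 2) ⇒ (var 1 ⇒ var 2) ⇒ (var 0 ∨' var 1 ⇒ var 2))
  exf  : IPCAxiom (⊥' ⇒ var 0)

data Smallest {a} (Γ : Formula → Set a) : Formula → Set a where
  ax  : ∀ {φ} → IPCAxiom φ → Smallest Γ φ
  hyp : ∀ {φ} → Γ φ → Smallest Γ φ
  mp  : ∀ {φ ψ} → Smallest Γ φ → Smallest Γ (φ ⇒ ψ) → Smallest Γ ψ
  sub : ∀ {φ} (σ : ℕ → Formula) → Smallest Γ φ → Smallest Γ (φ [ σ ])

module _ {c ℓ₁ ℓ₂} (F : Poset c ℓ₁ ℓ₂) where
  open Poset F

  private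
    L : Level
    L = c ⊔ ℓ₁ ⊔ ℓ₂

  UpClosed : (Carrier → Set L) → Set L
  UpClosed U = ∀ {x y} → x ≤ y → U x → U y

  Valuation : Set (lsuc L)
  Valuation = Σ (ℕ → Carrier → Set L) (λ V → ∀ i → UpClosed (V i))

  Forces : Valuation → Carrier → Formula → Set L
  Forces (V , _) x (var i) = V i x
  Forces V x ⊥'       = Lift L ⊥
  Forces V x (φ ∧' ψ) = Forces V x φ × Forces V x ψ
  Forces V x (φ ∨' ψ) = Forces V x φ ⊎ Forces V x ψ
  Forces V x (φ ⇒ ψ)  = ∀ y → x ≤ y → Forces V y φ → Forces V y ψ

  Valid : Formula → Set (lsuc L)
  Valid φ = ∀ (V : Valuation) (x : Carrier) → Forces V x φ

  ValidLogic : ∀ {a} → (Formula → Set a) → Set (lsuc L ⊔ a)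
  ValidLogic Λ = ∀ φ → Λ φ → Valid φ

  _<_ : Carrier → Carrier → Set (ℓ₁ ⊔ ℓ₂)
  x < y = x ≤ y × ¬ (x ≈ y)

  -- Every chain x₀ < x₁ < … < xₘ inside the subset X has m ≤ n,
  -- i.e. the height of X (sup of |chain| - 1) is at most n.
  HeightOfAtMost : ∀ {a} → (Carrier → Set a) → ℕ → Set (c ⊔ ℓ₁ ⊔ ℓ₂ ⊔ a)
  HeightOfAtMost X n =
    ∀ (m : ℕ) (ch : Fin (suc m) → Carrier) →
      (∀ i → X (ch i)) →
      (∀ (i : Fin m) → ch (inject₁ i) < ch (suc i)) →
      m ≤ℕ n

  HeightAtMost : ℕ → Set (c ⊔ ℓ₁ ⊔ ℓ₂)
  HeightAtMost = HeightOfAtMost {a = 0ℓ} (λ _ → Lift 0ℓ Data.Unit.⊤)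
    where import Data.Unit

  ↑ : Carrier → Carrier → Set ℓ₂
  ↑ x y = x ≤ y

  ⇑ : Carrier → Carrier → Set (ℓ₁ ⊔ ℓ₂)
  ⇑ x y = x < y

  DepthAtMost : Carrier → ℕ → Set (c ⊔ ℓ₁ ⊔ ℓ₂)
  DepthAtMost x n = HeightOfAtMost (↑ x) n

  DepthIsOne : Carrier → Set (c ⊔ ℓ₁ ⊔ ℓ₂)
  DepthIsOne x = DepthAtMost x 1 × ¬ DepthAtMost x 0

  DepthAboveOne : Carrier → Set (c ⊔ ℓ₁ ⊔ ℓ₂)
  DepthAboveOne x = ¬ DepthAtMost x 1

  CardAtMost2 : ∀ {a} → (Carrier → Set a) → Set (c ⊔ ℓ₁ ⊔ a)
  CardAtMost2 X = ∀ y₁ y₂ y₃ → X y₁ → X y₂ → X y₃ →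
    (y₁ ≈ y₂) ⊎ (y₁ ≈ y₃) ⊎ (y₂ ≈ y₃)

  -- Connectedness of X in the subspace topology of the Alexandrov
  -- topology (open sets = upward-closed sets): X cannot be covered by
  -- two open sets U, V whose traces on X are disjoint and nonempty.
  Connected : ∀ {a} → (Carrier → Set a) → Set (lsuc L ⊔ a)
  Connected X =
    ∀ (U V : Carrier → Set L) → UpClosed U → UpClosed V →
      (∀ y → X y → U y ⊎ V y) →
      (∀ y → X y → U y → V y → ⊥) →
      ¬ ((∃ λ y → X y × U y) × (∃ λ y → X y × V y))

Finite : ∀ {c ℓ₁ ℓ₂} → Poset c ℓ₁ ℓ₂ → Set (c ⊔ ℓ₁)
Finite F = ∃ λ k → Σ (Fin k → Carrier) λ e → ∀ x → ∃ λ i → e i ≈ x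
  where open Poset F

BD : ℕ → Formula → Set₁
BD n φ = ∀ (P : Poset 0ℓ 0ℓ 0ℓ) → Finite P → HeightAtMost P n → Valid P φ

-- A finite rooted poset is given on Fin k by a boolean order relation
-- with a root.  χ(Q) is the Jankov formula of the (finite subdirectly
-- irreducible) Heyting algebra Up(Q) of upsets of Q:
--   χ(Q) = ⋀ { p_{a∧b} ↔ p_a ∧ p_b , p_{a∨b} ↔ p_a ∨ p_b ,
--              p_{a→b} ↔ (p_a → p_b) | a , b ∈ Up(Q) } ∧ (p_∅ ↔ ⊥)
--          → p_s ,
-- where s = Q ∖ {root} is the second largest element of Up(Q), and
-- the variable p_a for an upset a is the binary code of a.

record FinRootedPoset : Set where
  field
    size : ℕ
    leq  : Fin size → Fin size → Bool
    root : Fin size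

module Jankov (Q : FinRootedPoset) where
  open FinRootedPoset Q

  Sub : ℕ → Set
  Sub k = Fin k → Bool

  allSubs : (k : ℕ) → List (Sub k)
  allSubs zero    = (λ ()) ∷ []
  allSubs (suc k) = concatMap
    (λ f → (λ { zero → false ; (suc i) → f i })
         ∷ (λ { zero → true  ; (suc i) → f i }) ∷ [])
    (allSubs k)

  elems : List (Fin size)
  elems = allFinL size

  isUpset : Sub size → Bool
  isUpset U = all (λ i → all (λ j → not (U i ∧ leq i j) ∨ U j) elems) elems

  upsets : List (Sub size)
  upsets = filterᵇ isUpset (allSubs size)

  code : ∀ {k} → Sub k → ℕ
  code {zero}  U = 0
  code {suc k} U = (if U zero then 1 else 0) + 2 * code (λ i → U (suc i))

  p : Sub size → Formula
  p U = var (code U)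

  meet join imp : Sub size → Sub size → Sub size
  meet U W i = U i ∧ W i
  join U W i = U i ∨ W i
  imp  U W i = all (λ j → not (leq i j) ∨ not (U j) ∨ W j) elems

  empty secondLargest : Sub size
  empty _ = false
  secondLargest i = not ⌊ i ≟ root ⌋

  conditions : List Formula
  conditions =
    (p empty ⇔' ⊥') ∷
    concatMap (λ a → concatMap (λ b →
        (p (meet a b) ⇔' (p a ∧' p b))
      ∷ (p (join a b) ⇔' (p a ∨' p b))
      ∷ (p (imp a b)  ⇔' (p a ⇒ p b))
      ∷ []) upsets) upsets

  χ : Formula
  χ = ⋀ conditions ⇒ p secondLargest

χ : FinRootedPoset → Formula
χ Q = Jankov.χ Q

Fork₃ : FinRootedPoset
Fork₃ = record { size = 4 ; leq = le ; root = zero }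
  where
  le : Fin 4 → Fin 4 → Bool
  le zero _ = true
  le i j = ⌊ i ≟ j ⌋

-- Scott: r = 0, a = 1, b = 2, c = 3 with r < a < b, r < c
Scott : FinRootedPoset
Scott = record { size = 4 ; leq = le ; root = zero }
  where
  le : Fin 4 → Fin 4 → Bool
  le zero _ = true
  le (suc zero) (suc (suc zero)) = true
  le i j = ⌊ i ≟ j ⌋

PLGen : ℕ → Formula → Set₁
PLGen n φ = BD n φ ⊎ Lift (lsuc 0ℓ) (φ ≡ χ Fork₃) ⊎ Lift (lsuc 0ℓ) (φ ≡ χ Scott)

PL : ℕ → Formula → Set₁
PL n = Smallest (PLGen n)

{-# OPTIONS --safe #-}
module Submission where

open import Defs
open import Level using (Level; _⊔_; 0ℓ; Lift; lift; lower) renaming (suc to lsuc)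
open import Data.Nat using (ℕ; zero; suc; z≤n; s≤s; _+_; _%_; _≡ᵇ_; ⌊_/2⌋)
  renaming (_≤_ to _≤ℕ_; _<_ to _<ℕ_)
open import Data.Nat.Properties using (≤-pred; +-suc; +-identityʳ; +-monoʳ-≤; m≤m+n)
import Data.Nat.Properties as ℕ
open import Data.Fin using (Fin; zero; suc; inject₁)
open import Data.Product using (Σ; ∃; _×_; _,_; proj₁; proj₂)
import Data.Product as Product
open import Data.Product.Function.NonDependent.Propositional using (_×-⇔_)
open import Data.Sum using (_⊎_; inj₁; inj₂; [_,_])
import Data.Sum as Sum
open import Data.Sum.Function.Propositional using (_⊎-⇔_)
open import Data.Empty using (⊥; ⊥-elim)
open import Data.Unit using (⊤; tt)
open import Data.Bool using (Bool; true; false; T; _∧_; _∨_)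
open import Data.Bool.Properties using (T-∧; T-∨)
open import Data.Bool.ListAction using (all; any)
open import Data.List using (List; []; _∷_; _++_; length; lookup; allFin; cartesianProductWith)
open import Data.List.Membership.Propositional using (_∈_)
open import Data.List.Membership.Propositional.Properties
  using (∈-++⁺ˡ; ∈-++⁺ʳ; ∈-cartesianProductWith⁺; ∈-allFin)
open import Data.List.Relation.Binary.Subset.Propositional using (_⊆_)
open import Data.List.Relation.Unary.All as All using (All; []; _∷_)
open import Data.List.Relation.Unary.All.Properties using (all⁺; all⁻)
open import Data.List.Relation.Unary.Any using (here; there; index)
open import Data.List.Relation.Unary.Any.Properties using (lookup-index)
open import Data.List.Relation.Binary.Pointwise using (Pointwise-≡⇒≡; ≡⇒Pointwise-≡)
open import Data.List.Relation.Binary.Suffix.Heterogeneous using (Suffix; here; there)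
import Data.List.Relation.Binary.Suffix.Heterogeneous.Properties as Suffix
import Data.List.Relation.Binary.Suffix.Homogeneous.Properties as Suffix
open import Function using (_∘_; id; flip; _⇔_; mk⇔; Equivalence)
open Equivalence using (to; from)
import Function.Properties.Equivalence as ⇔
open import Relation.Nullary using (¬_; Dec; yes; no)
open import Relation.Nullary.Decidable
  using (True; isYes; map′; toWitness; fromWitness; T?; decidable-stable)
open import Relation.Binary.PropositionalEquality using (_≡_; refl; sym; subst; cong; cong₂)
import Relation.Binary.PropositionalEquality as ≡
open import Relation.Binary.Bundles using (Poset)
import Relation.Binary.Construct.On as On
open import Axiom.ExcludedMiddle using (ExcludedMiddle)

-- A frame validates PL_n iff it validates its generators, since validity is closed under modus
-- ponens and substitution.
--
-- The formula bd n lies in BD_n and is refuted along any strict chain of length n + 1, so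
-- validating it bounds the height by n.  Conversely, if F has height at most n, a countermodel of
-- φ at x unravels into a finite tree of height at most n, whose points are paths from x through
-- witnesses refuting implicational subformulas of φ; the tree refutes φ too, so BD_n is valid on F.
--
-- If an upset of F maps onto Q by a p-morphism, the valuation pulled back from the upsets
-- of Q refutes χ(Q).  A depth-one point with three distinct successors yields such a map onto
-- Fork₃; a point of depth greater than one whose strict up-set is split by two upsets U, V yields
-- one onto Scott, sending a point of U with a successor to a, a maximal point above it to b, and a
-- point of V to c.  Conversely, a point refuting χ(Q) can be pushed up to a maximal point y
-- refuting the variable of Q ∖ {root}.  The conjuncts of χ(Q) then make the variables of the
-- upsets generated by the points of Q ∖ {root} cover ⇑y by disjoint nonempty upsets: three for
-- Fork₃, violating (ii) or (iii), and two for Scott, one containing a chain of length two, so that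
-- y has depth greater than one and (iii) fails.

lowerEM : ∀ {a} b → ExcludedMiddle (a ⊔ b) → ExcludedMiddle a
lowerEM b em = map′ lower lift (em {Lift b _})

listsUpTo : ∀ {a} {A : Set a} → List A → ℕ → List (List A)
listsUpTo xs zero    = [] ∷ []
listsUpTo xs (suc m) = [] ∷ cartesianProductWith _∷_ xs (listsUpTo xs m)

∈-listsUpTo : ∀ {a} {A : Set a} {xs : List A} {l} m →
  All (_∈ xs) l → length l ≤ℕ m → l ∈ listsUpTo xs m
∈-listsUpTo zero    []         _         = here refl
∈-listsUpTo (suc m) []         _         = here refl
∈-listsUpTo (suc m) (x∈ ∷ l∈) (s≤s len) =
  there (∈-cartesianProductWith⁺ _∷_ x∈ (∈-listsUpTo m l∈ len))

suffixPoset : ∀ {a} (A : Set a) → Poset a a a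
suffixPoset A = record
  { Carrier        = List A
  ; _≈_            = _≡_
  ; _≤_            = Suffix _≡_
  ; isPartialOrder = record
    { isPreorder = record
      { isEquivalence = ≡.isEquivalence
      ; reflexive     = λ { refl → here (≡⇒Pointwise-≡ refl) }
      ; trans         = Suffix.trans ≡.trans
      }
    ; antisym = λ s t → Pointwise-≡⇒≡ (Suffix.antisym (λ p _ → p) s t)
    }
  }

strictSuffix⇒length< : ∀ {a} {A : Set a} {l l′ : List A} →
  Suffix _≡_ l l′ → ¬ l ≡ l′ → length l <ℕ length l′
strictSuffix⇒length< (here eq) l≢l′ = ⊥-elim (l≢l′ (Pointwise-≡⇒≡ eq))
strictSuffix⇒length< (there s) _    = s≤s (Suffix.length-mono s)

infixr 4 _⇒ᵇ_
_⇒ᵇ_ : Bool → Bool → Bool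
true  ⇒ᵇ b = b
false ⇒ᵇ _ = true

T-⇒ᵇ : ∀ {a b} → T (a ⇒ᵇ b) ⇔ (T a → T b)
T-⇒ᵇ {true}  = mk⇔ (λ t _ → t) (λ f → f _)
T-⇒ᵇ {false} = mk⇔ (λ _ ()) (λ _ → _)

allOf : ∀ {k} → (Fin k → Bool) → Bool
allOf {k} p = all p (allFin k)

T-allOf : ∀ {k} {p : Fin k → Bool} → T (allOf p) ⇔ (∀ j → T (p j))
T-allOf {k} {p} = mk⇔ (λ h j → All.lookup (all⁺ p (allFin k) h) (∈-allFin j))
                      (λ h → all⁻ p (All.universal h (allFin k)))

-- decode (Jankov.code U) = U
decode : ∀ {k} → ℕ → Fin k → Bool
decode v zero    = v % 2 ≡ᵇ 1
decode v (suc i) = decode ⌊ v /2⌋ i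

-- bd k is the usual bd_{k+1}, with var 0 fresh for bdAbove k thanks to the shift.
bd bdAbove : ℕ → Formula
bd k = var 0 ∨' (var 0 ⇒ bdAbove k)
bdAbove zero    = ⊥'
bdAbove (suc k) = bd k [ var ∘ suc ]

subformulas : Formula → List Formula
subformulas (var i)  = var i ∷ []
subformulas ⊥'       = ⊥' ∷ []
subformulas (a ∧' b) = (a ∧' b) ∷ subformulas a ++ subformulas b
subformulas (a ∨' b) = (a ∨' b) ∷ subformulas a ++ subformulas b
subformulas (a ⇒ b)  = (a ⇒ b)  ∷ subformulas a ++ subformulas b

⊆-children : ∀ {c a b} {ys : List Formula} → c ∷ subformulas a ++ subformulas b ⊆ ys →
  subformulas a ⊆ ys × subformulas b ⊆ ys
⊆-children {a = a} ⊆ys = ⊆ys ∘ there ∘ ∈-++⁺ˡ , ⊆ys ∘ there ∘ ∈-++⁺ʳ (subformulas a)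

infix 4 _==_
_==_ : Formula → Formula → Bool
var i    == var j    = i ≡ᵇ j
⊥'       == ⊥'       = true
(a ∧' b) == (c ∧' d) = (a == c) ∧ (b == d)
(a ∨' b) == (c ∨' d) = (a == c) ∧ (b == d)
(a ⇒ b)  == (c ⇒ d)  = (a == c) ∧ (b == d)
_        == _        = false

==⇒≡ : ∀ φ ψ → T (φ == ψ) → φ ≡ ψ
==⇒≡ (var i)  (var j)  t = cong var (ℕ.≡ᵇ⇒≡ i j t)
==⇒≡ ⊥'       ⊥'       _ = refl
==⇒≡ (a ∧' b) (c ∧' d) t = cong₂ _∧'_ (==⇒≡ a c (proj₁ (to T-∧ t))) (==⇒≡ b d (proj₂ (to T-∧ t)))
==⇒≡ (a ∨' b) (c ∨' d) t = cong₂ _∨'_ (==⇒≡ a c (proj₁ (to T-∧ t))) (==⇒≡ b d (proj₂ (to T-∧ t)))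
==⇒≡ (a ⇒ b)  (c ⇒ d)  t = cong₂ _⇒_  (==⇒≡ a c (proj₁ (to T-∧ t))) (==⇒≡ b d (proj₂ (to T-∧ t)))

module Kripke {c ℓ₁ ℓ₂} (F : Poset c ℓ₁ ℓ₂) where
  open Poset F renaming (refl to ≤-refl; trans to ≤-trans)

  L : Level
  L = c ⊔ ℓ₁ ⊔ ℓ₂

  _⊏_ : Carrier → Carrier → Set (ℓ₁ ⊔ ℓ₂)
  _⊏_ = _<_ F

  ≤-∉⇒⊏ : ∀ {P : Carrier → Set L} {x y} → UpClosed F P → ¬ P x → x ≤ y → P y → x ⊏ y
  ≤-∉⇒⊏ up ¬Px x≤y Py = x≤y , λ x≈y → ¬Px (up (reflexive (Eq.sym x≈y)) Py)

  ≤∧≱⇒⊏ : ∀ {x y} → x ≤ y → ¬ y ≤ x → x ⊏ y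
  ≤∧≱⇒⊏ x≤y y≰x = x≤y , λ x≈y → y≰x (reflexive (Eq.sym x≈y))

  ⊏⇒≱ : ∀ {x y} → x ⊏ y → ¬ y ≤ x
  ⊏⇒≱ (x≤y , x≉y) y≤x = x≉y (antisym x≤y y≤x)

  ≤-⊏-trans : ∀ {x y z} → x ≤ y → y ⊏ z → x ⊏ z
  ≤-⊏-trans x≤y (y≤z , y≉z) =
    ≤-trans x≤y y≤z , λ x≈z → y≉z (antisym y≤z (≤-trans (reflexive (Eq.sym x≈z)) x≤y))

  forces-mono : ∀ V φ {x y} → x ≤ y → Forces F V x φ → Forces F V y φ
  forces-mono (_ , up) (var i)  x≤y p        = up i x≤y p
  forces-mono V        ⊥'       x≤y p        = p
  forces-mono V        (φ ∧' ψ) x≤y (p , q)  = forces-mono V φ x≤y p , forces-mono V ψ x≤y q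
  forces-mono V        (φ ∨' ψ) x≤y (inj₁ p) = inj₁ (forces-mono V φ x≤y p)
  forces-mono V        (φ ∨' ψ) x≤y (inj₂ q) = inj₂ (forces-mono V ψ x≤y q)
  forces-mono V        (φ ⇒ ψ)  x≤y p z y≤z  = p z (≤-trans x≤y y≤z)

  _⟨_⟩ : Valuation F → (ℕ → Formula) → Valuation F
  V ⟨ σ ⟩ = (λ i y → Forces F V y (σ i)) , (λ i → forces-mono V (σ i))

  forces-[]⁻ : ∀ V σ φ {x} → Forces F V x (φ [ σ ]) → Forces F (V ⟨ σ ⟩) x φ
  forces-[]⁺ : ∀ V σ φ {x} → Forces F (V ⟨ σ ⟩) x φ → Forces F V x (φ [ σ ])
  forces-[]⁻ V σ (var i)  p         = p
  forces-[]⁻ V σ ⊥'       p         = p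
  forces-[]⁻ V σ (φ ∧' ψ) (p , q)   = forces-[]⁻ V σ φ p , forces-[]⁻ V σ ψ q
  forces-[]⁻ V σ (φ ∨' ψ) (inj₁ p)  = inj₁ (forces-[]⁻ V σ φ p)
  forces-[]⁻ V σ (φ ∨' ψ) (inj₂ q)  = inj₂ (forces-[]⁻ V σ ψ q)
  forces-[]⁻ V σ (φ ⇒ ψ)  p y x≤y q = forces-[]⁻ V σ ψ (p y x≤y (forces-[]⁺ V σ φ q))
  forces-[]⁺ V σ (var i)  p         = p
  forces-[]⁺ V σ ⊥'       p         = p
  forces-[]⁺ V σ (φ ∧' ψ) (p , q)   = forces-[]⁺ V σ φ p , forces-[]⁺ V σ ψ q
  forces-[]⁺ V σ (φ ∨' ψ) (inj₁ p)  = inj₁ (forces-[]⁺ V σ φ p)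
  forces-[]⁺ V σ (φ ∨' ψ) (inj₂ q)  = inj₂ (forces-[]⁺ V σ ψ q)
  forces-[]⁺ V σ (φ ⇒ ψ)  p y x≤y q = forces-[]⁺ V σ ψ (p y x≤y (forces-[]⁻ V σ φ q))

  forces-⋀ : ∀ V {w} φ cs → T (any (φ ==_) cs) → Forces F V w (⋀ cs) → Forces F V w φ
  forces-⋀ V φ (ψ ∷ cs) t (p , ps) with to (T-∨ {φ == ψ}) t
  ... | inj₁ φ=ψ  = subst (Forces F V _) (sym (==⇒≡ φ ψ φ=ψ)) p
  ... | inj₂ φ∈cs = forces-⋀ V φ cs φ∈cs ps

  ipcAxiom-valid : ∀ {φ} → IPCAxiom φ → Valid F φ
  ipcAxiom-valid K   V _ _ _ p z y≤z _         = forces-mono V (var 0) y≤z p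
  ipcAxiom-valid S   V _ _ _ f _ y≤z g w z≤w p = f w (≤-trans y≤z z≤w) p w ≤-refl (g w z≤w p)
  ipcAxiom-valid ∧E₁ V _ _ _ (p , _)           = p
  ipcAxiom-valid ∧E₂ V _ _ _ (_ , q)           = q
  ipcAxiom-valid ∧I  V _ _ _ p z y≤z q         = forces-mono V (var 0) y≤z p , q
  ipcAxiom-valid ∨I₁ V _ _ _ p                 = inj₁ p
  ipcAxiom-valid ∨I₂ V _ _ _ q                 = inj₂ q
  ipcAxiom-valid ∨E  V _ _ _ f _ y≤z g w z≤w   = [ f w (≤-trans y≤z z≤w) , g w z≤w ]
  ipcAxiom-valid exf V _ _ _ p                 = ⊥-elim (lower p)

  smallest-valid : ∀ {a} {Γ : Formula → Set a} →
    (∀ φ → Γ φ → Valid F φ) → ValidLogic F (Smallest Γ)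
  smallest-valid Γ-valid φ (ax a)  = ipcAxiom-valid a
  smallest-valid Γ-valid φ (hyp g) = Γ-valid φ g
  smallest-valid Γ-valid φ (mp p q) V x =
    smallest-valid Γ-valid _ q V x x ≤-refl (smallest-valid Γ-valid _ p V x)
  smallest-valid Γ-valid _ (sub {φ} σ p) V x =
    forces-[]⁺ V σ φ (smallest-valid Γ-valid φ p (V ⟨ σ ⟩) x)

  infixr 5 _◅_
  data Chain : Carrier → ℕ → Set L where
    ε   : ∀ {x} → Chain x 0
    _◅_ : ∀ {x y m} → x ⊏ y → Chain y m → Chain x (suc m)

  take : ∀ {x m k} → k ≤ℕ m → Chain x m → Chain x k
  take z≤n       _        = ε
  take (s≤s k≤m) (c ◅ ch) = c ◅ take k≤m ch

  fromSteps : ∀ {m} (ch : Fin (suc m) → Carrier) →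
    (∀ (i : Fin m) → ch (inject₁ i) ⊏ ch (suc i)) → Chain (ch zero) m
  fromSteps {zero}  ch steps = ε
  fromSteps {suc m} ch steps = steps zero ◅ fromSteps (ch ∘ suc) (steps ∘ suc)

  point : ∀ {x m} → Chain x m → Fin (suc m) → Carrier
  point {x} _        zero    = x
  point     (_ ◅ ch) (suc i) = point ch i

  point-steps : ∀ {x m} (ch : Chain x m) (i : Fin m) → point ch (inject₁ i) ⊏ point ch (suc i)
  point-steps (c ◅ ch) zero    = c
  point-steps (c ◅ ch) (suc i) = point-steps ch i

  point-≥ : ∀ {x m} (ch : Chain x m) i → x ≤ point ch i
  point-≥ ch       zero    = ≤-refl
  point-≥ (c ◅ ch) (suc i) = ≤-trans (proj₁ c) (point-≥ ch i)

  chain⇒¬depth≤ : ∀ {x k} → Chain x (suc k) → ¬ DepthAtMost F x k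
  chain⇒¬depth≤ ch depth≤ = ℕ.<-irrefl refl (depth≤ _ (point ch) (point-≥ ch) (point-steps ch))

  Bounded : Carrier → ℕ → Set L
  Bounded x k = ∀ {m} → Chain x m → m ≤ℕ k

  height⇒bounded : ∀ {n} → HeightAtMost F n → ∀ x → Bounded x n
  height⇒bounded height x ch = height _ (point ch) (λ _ → lift tt) (point-steps ch)

  bounded-⊏ : ∀ {x y k} → Bounded x (suc k) → x ⊏ y → Bounded y k
  bounded-⊏ bounded x⊏y ch = ≤-pred (bounded (x⊏y ◅ ch))

  Separated : ∀ {x m} → (ℕ → Carrier → Set L) → Chain x m → Set L
  Separated     P ε                  = Lift L ⊤
  Separated {x} P (_◅_ {y = y} _ ch) = P 0 y × ¬ P 0 x × Separated (P ∘ suc) ch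

  separated-¬bd      : ∀ k {x} (ch : Chain x (suc k)) V →
    Separated (proj₁ V) ch → ¬ Forces F V x (bd k)
  separated-¬bdAbove : ∀ k {x} (ch : Chain x k) V →
    Separated (proj₁ V ∘ suc) ch → ¬ Forces F V x (bdAbove k)
  separated-¬bd k (_ ◅ _)    V (_ , ¬Px , _)  (inj₁ Px) = ¬Px Px
  separated-¬bd k (x⊏y ◅ ch) V (Py , _ , sep) (inj₂ g)  =
    separated-¬bdAbove k ch V sep (g _ (proj₁ x⊏y) Py)
  separated-¬bdAbove zero    ε  V _   = lower
  separated-¬bdAbove (suc k) ch V sep =
    separated-¬bd k ch (V ⟨ var ∘ suc ⟩) sep ∘ forces-[]⁻ V (var ∘ suc) (bd k)

  above : ∀ {x m} → Chain x m → ℕ → Carrier → Set L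
  above ε                 _       _ = Lift L ⊥
  above (_◅_ {y = y} _ _) zero    z = Lift L (y ≤ z)
  above (_ ◅ ch)          (suc i) z = above ch i z

  above-up : ∀ {x m} (ch : Chain x m) i → UpClosed F (above ch i)
  above-up ε        _       _   ()
  above-up (_ ◅ _)  zero    z≤w y≤z = lift (≤-trans (lower y≤z) z≤w)
  above-up (_ ◅ ch) (suc i) z≤w p   = above-up ch i z≤w p

  separated-above : ∀ {x m} (ch : Chain x m) → Separated (above ch) ch
  separated-above ε        = lift tt
  separated-above (c ◅ ch) = lift ≤-refl , ⊏⇒≱ c ∘ lower , separated-above ch

  bd-valid⇒height : ∀ {n} → Valid F (bd n) → HeightAtMost F n
  bd-valid⇒height {n} valid m ch _ steps with m ℕ.≤? n
  ... | yes m≤n = m≤n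
  ... | no  m≰n = ⊥-elim (separated-¬bd n tooLong (above tooLong , above-up tooLong)
                            (separated-above tooLong) (valid _ (ch zero)))
    where tooLong = take (ℕ.≰⇒> m≰n) (fromSteps ch steps)

module Classical {c ℓ₁ ℓ₂} (em : ExcludedMiddle (c ⊔ ℓ₁ ⊔ ℓ₂)) (F : Poset c ℓ₁ ℓ₂) where
  open Poset F renaming (refl to ≤-refl; trans to ≤-trans)
  open Kripke F

  _≤?_ : ∀ x y → Dec (x ≤ y)
  _ ≤? _ = lowerEM (c ⊔ ℓ₁) em

  ≤⇒≈⊎⊏ : ∀ {x y} → x ≤ y → x ≈ y ⊎ x ⊏ y
  ≤⇒≈⊎⊏ {x} {y} x≤y with lowerEM (c ⊔ ℓ₂) em {x ≈ y}
  ... | yes x≈y = inj₁ x≈y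
  ... | no  x≉y = inj₂ (x≤y , x≉y)

  counterexample : ∀ {x} (P Q : Carrier → Set L) →
    ¬ (∀ y → x ≤ y → P y → Q y) → ∃ λ y → x ≤ y × P y × ¬ Q y
  counterexample P Q ¬P⊆Q with em {∃ λ y → _ ≤ y × P y × ¬ Q y}
  ... | yes found = found
  ... | no  none  = ⊥-elim (¬P⊆Q λ y x≤y Py → decidable-stable em λ ¬Qy → none (y , x≤y , Py , ¬Qy))

  maximal-above : ∀ (P : Carrier → Set L) k {z} → Bounded z k → P z →
    ∃ λ w → z ≤ w × P w × (∀ w′ → w ⊏ w′ → ¬ P w′)
  maximal-above P k {z} bounded Pz with em {∃ λ w′ → z ⊏ w′ × P w′}
  ... | no  none = z , ≤-refl , Pz , λ w′ z⊏w′ Pw′ → none (w′ , z⊏w′ , Pw′)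
  maximal-above P zero    bounded Pz | yes (w′ , z⊏w′ , _) with () ← bounded (z⊏w′ ◅ ε)
  maximal-above P (suc k) bounded Pz | yes (w′ , z⊏w′ , Pw′) =
    let w , w′≤w , Pw , maximal = maximal-above P k (bounded-⊏ bounded z⊏w′) Pw′
    in  w , ≤-trans (proj₁ z⊏w′) w′≤w , Pw , maximal

  bounded⇒bd      : ∀ V k {x} → Bounded x k → Forces F V x (bd k)
  bounded⇒bdAbove : ∀ V k {x y} → Bounded x k → x ⊏ y → Forces F V y (bdAbove k)
  bounded⇒bd V k {x} bounded with em {proj₁ V 0 x}
  ... | yes Px = inj₁ Px
  ... | no ¬Px = inj₂ λ y x≤y Py → bounded⇒bdAbove V k bounded (≤-∉⇒⊏ (proj₂ V 0) ¬Px x≤y Py)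
  bounded⇒bdAbove V zero    bounded x⊏y with () ← bounded (x⊏y ◅ ε)
  bounded⇒bdAbove V (suc k) bounded x⊏y =
    forces-[]⁺ V (var ∘ suc) (bd k) (bounded⇒bd (V ⟨ var ∘ suc ⟩) k (bounded-⊏ bounded x⊏y))

  depth≤1-maximal : ∀ {x y z} → DepthAtMost F x 1 → x ⊏ y → y ≤ z → z ≤ y
  depth≤1-maximal depth≤1 x⊏y y≤z with ≤⇒≈⊎⊏ y≤z
  ... | inj₁ y≈z = reflexive (Eq.sym y≈z)
  ... | inj₂ y⊏z = ⊥-elim (chain⇒¬depth≤ (x⊏y ◅ y⊏z ◅ ε) depth≤1)

  ¬depth≤1⇒⊏⊏ : ∀ {x} → ¬ DepthAtMost F x 1 → ∃ λ y → ∃ λ z → x ⊏ y × y ⊏ z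
  ¬depth≤1⇒⊏⊏ {x} ¬depth≤1 = decidable-stable em λ none → ¬depth≤1 λ where
    zero          _  _  _     → z≤n
    (suc zero)    _  _  _     → s≤s z≤n
    (suc (suc m)) ch x≤ steps →
      ⊥-elim (none (_ , _ , ≤-⊏-trans (x≤ zero) (steps zero) , steps (suc zero)))

bd∈BD : ExcludedMiddle 0ℓ → ∀ n → BD n (bd n)
bd∈BD em n P _ height V x = Classical.bounded⇒bd em P V n (Kripke.height⇒bounded P height x)

-- The tree of paths from root in which each step i ∷ l goes strictly up from walk l to a point
-- refuting the implication `formula i`.  Its points are the genuine lists, ordered by suffix.
module Unravelling {c ℓ₁ ℓ₂} (em : ExcludedMiddle (c ⊔ ℓ₁ ⊔ ℓ₂)) (F : Poset c ℓ₁ ℓ₂)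
  {n} (height : HeightAtMost F n) (φ : Formula) (V : Valuation F) (root : Poset.Carrier F) where
  open Poset F renaming (refl to ≤-refl; trans to ≤-trans)
  open Kripke F
  open Classical em F

  Index : Set
  Index = Fin (length (subformulas φ))

  formula : Index → Formula
  formula = lookup (subformulas φ)

  Refutes : Formula → Carrier → Set L
  Refutes (a ⇒ b) z = Forces F V z a × ¬ Forces F V z b
  Refutes _       _ = Lift L ⊥

  WitnessAbove : Index → Carrier → Set L
  WitnessAbove i y = ∃ λ z → y ⊏ z × Refutes (formula i) z

  next : Index → Carrier → Carrier
  next i y with em {WitnessAbove i y}
  ... | yes (z , _) = z
  ... | no  _       = y

  next-≥ : ∀ i y → y ≤ next i y
  next-≥ i y with em {WitnessAbove i y}
  ... | yes (_ , y⊏z , _) = proj₁ y⊏z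
  ... | no  _             = ≤-refl

  next-witness : ∀ i y → True (em {WitnessAbove i y}) → y ⊏ next i y × Refutes (formula i) (next i y)
  next-witness i y found with em {WitnessAbove i y}
  ... | yes (_ , y⊏z , refutes) = y⊏z , refutes

  walk : List Index → Carrier
  walk []      = root
  walk (i ∷ l) = next i (walk l)

  genuine : List Index → Bool
  genuine []      = true
  genuine (i ∷ l) = genuine l ∧ isYes (em {WitnessAbove i (walk l)})

  walk-mono : ∀ {l l′} → Suffix _≡_ l l′ → walk l ≤ walk l′
  walk-mono (here eq) rewrite Pointwise-≡⇒≡ eq = ≤-refl
  walk-mono {l′ = i ∷ l′} (there s) = ≤-trans (walk-mono s) (next-≥ i (walk l′))

  genuine-step : ∀ i l → T (genuine (i ∷ l)) → walk l ⊏ walk (i ∷ l)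
  genuine-step i l g = proj₁ (next-witness i (walk l) (proj₂ (to T-∧ g)))

  genuine-chain : ∀ l → T (genuine l) → ∀ {m} → Chain (walk l) m → Chain root (length l + m)
  genuine-chain []      g ch = ch
  genuine-chain (i ∷ l) g {m} ch = subst (Chain root) (+-suc (length l) m)
    (genuine-chain l (proj₁ (to T-∧ g)) (genuine-step i l g ◅ ch))

  genuine-length : ∀ l → T (genuine l) → length l ≤ℕ n
  genuine-length l g = subst (_≤ℕ n) (+-identityʳ (length l))
    (height⇒bounded height root (genuine-chain l g ε))

  Point : Set
  Point = Σ (List Index) (T ∘ genuine)

  Tree : Poset 0ℓ 0ℓ 0ℓ
  Tree = On.poset (suffixPoset Index) (proj₁ {B = T ∘ genuine})

  toPoint : List Index → Point
  toPoint l with T? (genuine l)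
  ... | yes g = l , g
  ... | no  _ = [] , tt

  toPoint-genuine : ∀ l → T (genuine l) → proj₁ (toPoint l) ≡ l
  toPoint-genuine l g with T? (genuine l)
  ... | yes _ = refl
  ... | no ¬g = ⊥-elim (¬g g)

  Tree-finite : Finite Tree
  Tree-finite = _ , toPoint ∘ lookup candidates , enumerated
    where
    candidates : List (List Index)
    candidates = listsUpTo (allFin _) n
    enumerated : ∀ t → ∃ λ k → proj₁ (toPoint (lookup candidates k)) ≡ proj₁ t
    enumerated (l , g) =
      index l∈ , subst (λ l′ → proj₁ (toPoint l′) ≡ l) (lookup-index l∈) (toPoint-genuine l g)
      where l∈ = ∈-listsUpTo n (All.universal ∈-allFin l) (genuine-length l g)

  module Tree = Kripke Tree

  Tree-chain-length : ∀ {t m} → Tree.Chain t m →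
    ∃ λ (t′ : Point) → m + length (proj₁ t) ≤ℕ length (proj₁ t′)
  Tree-chain-length {t} ε = t , ℕ.≤-refl
  Tree-chain-length {t} {suc m} (_◅_ {y = u} (t≤u , t≢u) ch) = t′ , (begin
      suc m + length (proj₁ t)   ≡⟨ +-suc m _ ⟨
      m + suc (length (proj₁ t)) ≤⟨ +-monoʳ-≤ m (strictSuffix⇒length< t≤u t≢u) ⟩
      m + length (proj₁ u)       ≤⟨ len ⟩
      length (proj₁ t′)          ∎)
    where
    open ℕ.≤-Reasoning
    t′ = proj₁ (Tree-chain-length ch)
    len = proj₂ (Tree-chain-length ch)

  Tree-height : HeightAtMost Tree n
  Tree-height m ch _ steps =
    let t′ , len = Tree-chain-length (Tree.fromSteps ch steps)
    in  ℕ.≤-trans (m≤m+n m _) (ℕ.≤-trans len (genuine-length (proj₁ t′) (proj₂ t′)))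

  -- True turns the large predicates of V into propositions in Set.
  Tree-valuation : Valuation Tree
  Tree-valuation = (λ j t → True (em {proj₁ V j (walk (proj₁ t))})) ,
                   (λ j t≤t′ h → fromWitness (proj₂ V j (walk-mono t≤t′) (toWitness h)))

  extend : ∀ t {a b} → (a ⇒ b) ∈ subformulas φ →
    (∃ λ z → walk (proj₁ t) ⊏ z × Refutes (a ⇒ b) z) →
    ∃ λ t′ → Poset._≤_ Tree t t′ × Refutes (a ⇒ b) (walk (proj₁ t′))
  extend (l , g) a⇒b∈ (z , l⊏z , refutes) =
    (i ∷ l , from T-∧ (g , found)) , there (here (≡⇒Pointwise-≡ refl)) ,
    subst (λ ψ → Refutes ψ (walk (i ∷ l))) (sym (lookup-index a⇒b∈))
      (proj₂ (next-witness i (walk l) found))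
    where
    i = index a⇒b∈
    found : True (em {WitnessAbove i (walk l)})
    found = fromWitness (z , l⊏z , subst (λ ψ → Refutes ψ z) (lookup-index a⇒b∈) refutes)

  truth : ∀ ψ → subformulas ψ ⊆ subformulas φ → ∀ t →
    Forces Tree Tree-valuation t ψ ⇔ Forces F V (walk (proj₁ t)) ψ
  truth (var j) _ t = mk⇔ toWitness fromWitness
  truth ⊥'      _ t = mk⇔ (lift ∘ lower) (lift ∘ lower)
  truth (a ∧' b) ⊆φ t =
    let ⊆a , ⊆b = ⊆-children ⊆φ ; A = truth a ⊆a t ; B = truth b ⊆b t
    in  mk⇔ (Product.map (to A) (to B)) (Product.map (from A) (from B))
  truth (a ∨' b) ⊆φ t =
    let ⊆a , ⊆b = ⊆-children ⊆φ ; A = truth a ⊆a t ; B = truth b ⊆b t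
    in  mk⇔ (Sum.map (to A) (to B)) (Sum.map (from A) (from B))
  truth (a ⇒ b) ⊆φ (l , g) = mk⇔ toF toTree
    where
    ⊆a = proj₁ (⊆-children ⊆φ)
    ⊆b = proj₂ (⊆-children ⊆φ)
    toTree : Forces F V (walk l) (a ⇒ b) → Forces Tree Tree-valuation (l , g) (a ⇒ b)
    toTree ⇒F t′ t≤t′ at′ = from (truth b ⊆b t′) (⇒F _ (walk-mono t≤t′) (to (truth a ⊆a t′) at′))
    along-walk : Forces Tree Tree-valuation (l , g) (a ⇒ b) → ∀ t′ → Poset._≤_ Tree (l , g) t′ →
      Forces F V (walk (proj₁ t′)) a → Forces F V (walk (proj₁ t′)) b
    along-walk ⇒Tree t′ t≤t′ at′ = to (truth b ⊆b t′) (⇒Tree t′ t≤t′ (from (truth a ⊆a t′) at′))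
    toF : Forces Tree Tree-valuation (l , g) (a ⇒ b) → Forces F V (walk l) (a ⇒ b)
    toF ⇒Tree = decidable-stable em λ ¬⇒F →
      let z , l≤z , az , ¬bz = counterexample (λ z → Forces F V z a) (λ z → Forces F V z b) ¬⇒F
      in  Sum.[ (λ l≈z → ¬bz (forces-mono V b l≤z (along-walk ⇒Tree (l , g) (here (≡⇒Pointwise-≡ refl))
                                (forces-mono V a (reflexive (Eq.sym l≈z)) az))))
              , (λ l⊏z → let t′ , t≤t′ , at′ , ¬bt′ =
                                   extend (l , g) (⊆φ (here refl)) (z , l⊏z , az , ¬bz)
                         in  ¬bt′ (along-walk ⇒Tree t′ t≤t′ at′))
              ] (≤⇒≈⊎⊏ l≤z)

  bd-sound : BD n φ → Forces F V root φ
  bd-sound bdφ = to (truth φ id ([] , tt)) (bdφ Tree Tree-finite Tree-height Tree-valuation ([] , tt))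

-- eval φ q is the truth value of φ at q in Q when var v denotes the largest upset inside
-- decode v; on the variables of χ Q this is the upset coded by v.
module Evaluation (Q : FinRootedPoset) where
  open FinRootedPoset Q

  eval : Formula → Fin size → Bool
  eval (var v)  q = allOf λ j → leq q j ⇒ᵇ decode v j
  eval ⊥'       q = false
  eval (φ ∧' ψ) q = eval φ q ∧ eval ψ q
  eval (φ ∨' ψ) q = eval φ q ∨ eval ψ q
  eval (φ ⇒ ψ)  q = allOf λ j → leq q j ⇒ᵇ eval φ j ⇒ᵇ eval ψ j

  transitiveᵇ : Bool
  transitiveᵇ = allOf λ i → allOf λ j → allOf λ k → leq i j ⇒ᵇ leq j k ⇒ᵇ leq i k

  leq-trans : T transitiveᵇ → ∀ {i j k} → T (leq i j) → T (leq j k) → T (leq i k)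
  leq-trans t {i} {j} {k} i≤j j≤k =
    to T-⇒ᵇ (to T-⇒ᵇ (to T-allOf (to T-allOf (to T-allOf t i) j) k) i≤j) j≤k

  module PMorphism {a b d} (G : Poset a b d) (transitive : T transitiveᵇ) (x : Poset.Carrier G)
    (f : Poset.Carrier G → Fin size)
    (f-mono : ∀ {z z′} → Poset._≤_ G x z → Poset._≤_ G z z′ → T (leq (f z) (f z′)))
    (f-back : ∀ {z} j → Poset._≤_ G x z → T (leq (f z) j) → ∃ λ z′ → Poset._≤_ G z z′ × f z′ ≡ j)
    where
    open Poset G renaming (refl to ≤-refl; trans to ≤-trans)

    V : Valuation G
    V = (λ v y → Lift (a ⊔ b ⊔ d) (x ≤ y × (∀ j → T (leq (f y) j) → T (decode v j)))) ,
        (λ v y≤y′ (lift (x≤y , h)) →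
          lift (≤-trans x≤y y≤y′ , λ j fy′≤j → h j (leq-trans transitive (f-mono x≤y y≤y′) fy′≤j)))

    truth : ∀ φ {y} → x ≤ y → Forces G V y φ ⇔ T (eval φ (f y))
    truth (var v) x≤y =
      mk⇔ (λ (lift (_ , h)) → from T-allOf λ j → from T-⇒ᵇ (h j))
          (λ t → lift (x≤y , λ j → to T-⇒ᵇ (to T-allOf t j)))
    truth ⊥'       x≤y = mk⇔ lower λ ()
    truth (φ ∧' ψ) x≤y = ⇔.trans (truth φ x≤y ×-⇔ truth ψ x≤y) (⇔.sym T-∧)
    truth (φ ∨' ψ) x≤y = ⇔.trans (truth φ x≤y ⊎-⇔ truth ψ x≤y) (⇔.sym T-∨)
    truth (φ ⇒ ψ) {y} x≤y = mk⇔ forcing⇒eval eval⇒forcing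
      where
      forcing⇒eval : Forces G V y (φ ⇒ ψ) → T (eval (φ ⇒ ψ) (f y))
      forcing⇒eval imp = from T-allOf λ j → from T-⇒ᵇ λ fy≤j → from T-⇒ᵇ λ φj →
        let z , y≤z , fz≡j = f-back j x≤y fy≤j
            x≤z = ≤-trans x≤y y≤z
        in  subst (T ∘ eval ψ) fz≡j
              (to (truth ψ x≤z) (imp z y≤z (from (truth φ x≤z) (subst (T ∘ eval φ) (sym fz≡j) φj))))
      eval⇒forcing : T (eval (φ ⇒ ψ) (f y)) → Forces G V y (φ ⇒ ψ)
      eval⇒forcing t z y≤z φz = from (truth ψ x≤z)
        (to T-⇒ᵇ (to T-⇒ᵇ (to T-allOf t (f z)) (f-mono x≤y y≤z)) (to (truth φ x≤z) φz))
        where x≤z = ≤-trans x≤y y≤z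

    valid⇒eval : ∀ φ → Valid G φ → T (eval φ (f x))
    valid⇒eval φ valid = to (truth φ ≤-refl) (valid V x)

pattern #0 = zero
pattern #1 = suc zero
pattern #2 = suc (suc zero)
pattern #3 = suc (suc (suc zero))

fork-leaf-maximal : ∀ i j → T (FinRootedPoset.leq Fork₃ (suc i) j) → suc i ≡ j
fork-leaf-maximal i j = toWitness

module ForkRefutation {c ℓ₁ ℓ₂} (em : ExcludedMiddle (c ⊔ ℓ₁ ⊔ ℓ₂)) (F : Poset c ℓ₁ ℓ₂)
  (x y₁ y₂ y₃ : Poset.Carrier F) (depth≤1 : DepthAtMost F x 1)
  (x⊏y₁ : _<_ F x y₁) (x⊏y₂ : _<_ F x y₂) (x⊏y₃ : _<_ F x y₃)
  (y₁≉y₂ : ¬ Poset._≈_ F y₁ y₂) (y₁≉y₃ : ¬ Poset._≈_ F y₁ y₃) (y₂≉y₃ : ¬ Poset._≈_ F y₂ y₃)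
  where
  open Poset F renaming (refl to ≤-refl; trans to ≤-trans)
  open Kripke F
  open Classical em F
  open Evaluation Fork₃
  open FinRootedPoset Fork₃ using (leq)

  ≉⇒≰ : ∀ {y y′} → x ⊏ y → ¬ y ≈ y′ → ¬ y ≤ y′
  ≉⇒≰ x⊏y y≉y′ y≤y′ = y≉y′ (antisym y≤y′ (depth≤1-maximal depth≤1 x⊏y y≤y′))

  -- Every point of ⇑x is maximal, so leaf #3 can absorb y₃ together with any further successors.
  data Class (z : Carrier) : Fin 4 → Set L where
    below  : ¬ y₁ ≤ z → ¬ y₂ ≤ z → z ≤ x → Class z #0
    above₁ : y₁ ≤ z → Class z #1
    above₂ : ¬ y₁ ≤ z → y₂ ≤ z → Class z #2
    other  : ¬ y₁ ≤ z → ¬ y₂ ≤ z → ¬ z ≤ x → Class z #3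

  classify : ∀ z → ∃ (Class z)
  classify z with y₁ ≤? z | y₂ ≤? z | z ≤? x
  ... | yes y₁≤z | _        | _       = #1 , above₁ y₁≤z
  ... | no  y₁≰z | yes y₂≤z | _       = #2 , above₂ y₁≰z y₂≤z
  ... | no  y₁≰z | no  y₂≰z | yes z≤x = #0 , below y₁≰z y₂≰z z≤x
  ... | no  y₁≰z | no  y₂≰z | no  z≰x = #3 , other y₁≰z y₂≰z z≰x

  class-unique : ∀ {z i j} → Class z i → Class z j → i ≡ j
  class-unique (below _ _ _)  (below _ _ _)  = refl
  class-unique (below ¬p _ _) (above₁ p)     = ⊥-elim (¬p p)
  class-unique (below _ ¬p _) (above₂ _ p)   = ⊥-elim (¬p p)
  class-unique (below _ _ p)  (other _ _ ¬p) = ⊥-elim (¬p p)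
  class-unique (above₁ p)     (below ¬p _ _) = ⊥-elim (¬p p)
  class-unique (above₁ _)     (above₁ _)     = refl
  class-unique (above₁ p)     (above₂ ¬p _)  = ⊥-elim (¬p p)
  class-unique (above₁ p)     (other ¬p _ _) = ⊥-elim (¬p p)
  class-unique (above₂ _ p)   (below _ ¬p _) = ⊥-elim (¬p p)
  class-unique (above₂ ¬p _)  (above₁ p)     = ⊥-elim (¬p p)
  class-unique (above₂ _ _)   (above₂ _ _)   = refl
  class-unique (above₂ _ p)   (other _ ¬p _) = ⊥-elim (¬p p)
  class-unique (other _ _ ¬p) (below _ _ p)  = ⊥-elim (¬p p)
  class-unique (other ¬p _ _) (above₁ p)     = ⊥-elim (¬p p)
  class-unique (other _ ¬p _) (above₂ _ p)   = ⊥-elim (¬p p)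
  class-unique (other _ _ _)  (other _ _ _)  = refl

  f : Carrier → Fin 4
  f = proj₁ ∘ classify

  f-class : ∀ {z j} → Class z j → f z ≡ j
  f-class {z} = class-unique (proj₂ (classify z))

  f-mono : ∀ {z z′} → x ≤ z → z ≤ z′ → T (leq (f z) (f z′))
  f-mono {z} {z′} x≤z z≤z′ = go (proj₂ (classify z)) (proj₂ (classify z′))
    where
    z′≤z : ¬ z ≤ x → z′ ≤ z
    z′≤z z≰x = depth≤1-maximal depth≤1 (≤∧≱⇒⊏ x≤z z≰x) z≤z′
    go : ∀ {i j} → Class z i → Class z′ j → T (leq i j)
    go (below _ _ _)      _                = _
    go (above₁ _)         (above₁ _)       = _
    go (above₁ y₁≤z)      (below ¬p _ _)   = ¬p (≤-trans y₁≤z z≤z′)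
    go (above₁ y₁≤z)      (above₂ ¬p _)    = ¬p (≤-trans y₁≤z z≤z′)
    go (above₁ y₁≤z)      (other ¬p _ _)   = ¬p (≤-trans y₁≤z z≤z′)
    go (above₂ _ y₂≤z)    (above₁ y₁≤z′)   =
      ≉⇒≰ x⊏y₁ y₁≉y₂ (≤-trans y₁≤z′ (depth≤1-maximal depth≤1 x⊏y₂ (≤-trans y₂≤z z≤z′)))
    go (above₂ _ _)       (above₂ _ _)     = _
    go (above₂ _ y₂≤z)    (below _ ¬p _)   = ¬p (≤-trans y₂≤z z≤z′)
    go (above₂ _ y₂≤z)    (other _ ¬p _)   = ¬p (≤-trans y₂≤z z≤z′)
    go (other _ _ _)      (other _ _ _)    = _
    go (other _ _ z≰x)    (below _ _ z′≤x) = z≰x (≤-trans z≤z′ z′≤x)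
    go (other y₁≰z _ z≰x) (above₁ y₁≤z′)   = y₁≰z (≤-trans y₁≤z′ (z′≤z z≰x))
    go (other _ y₂≰z z≰x) (above₂ _ y₂≤z′) = y₂≰z (≤-trans y₂≤z′ (z′≤z z≰x))

  f-back : ∀ {z} j → x ≤ z → T (leq (f z) j) → ∃ λ z′ → z ≤ z′ × f z′ ≡ j
  f-back {z} j x≤z fz≤j with classify z
  ... | suc i , z∈i = z , ≤-refl , ≡.trans (f-class z∈i) (fork-leaf-maximal i j fz≤j)
  ... | #0 , z∈0@(below _ _ z≤x) with j
  ...   | #0 = z , ≤-refl , f-class z∈0
  ...   | #1 = y₁ , ≤-trans z≤x (proj₁ x⊏y₁) , f-class (above₁ ≤-refl)
  ...   | #2 = y₂ , ≤-trans z≤x (proj₁ x⊏y₂) , f-class (above₂ (≉⇒≰ x⊏y₁ y₁≉y₂) ≤-refl)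
  ...   | #3 = y₃ , ≤-trans z≤x (proj₁ x⊏y₃) ,
               f-class (other (≉⇒≰ x⊏y₁ y₁≉y₃) (≉⇒≰ x⊏y₂ y₂≉y₃) (⊏⇒≱ x⊏y₃))

  fork-refuted : ¬ Valid F (χ Fork₃)
  fork-refuted valid = subst (T ∘ eval (χ Fork₃)) (f-class (below (⊏⇒≱ x⊏y₁) (⊏⇒≱ x⊏y₂) ≤-refl))
    (PMorphism.valid⇒eval F _ x f f-mono f-back (χ Fork₃) valid)

scott-upper-maximal : ∀ i j → T (FinRootedPoset.leq Scott (suc (suc i)) j) → suc (suc i) ≡ j
scott-upper-maximal i j = toWitness

module ScottRefutation {o ℓ₁ ℓ₂} (em : ExcludedMiddle (o ⊔ ℓ₁ ⊔ ℓ₂)) (F : Poset o ℓ₁ ℓ₂)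
  {n} (height : HeightAtMost F n) (x : Poset.Carrier F)
  (U V : Poset.Carrier F → Set (o ⊔ ℓ₁ ⊔ ℓ₂)) (U-up : UpClosed F U) (V-up : UpClosed F V)
  (cover : ∀ y → ⇑ F x y → U y ⊎ V y) (disjoint : ∀ y → ⇑ F x y → U y → V y → ⊥)
  (a b c : Poset.Carrier F) (x⊏a : _<_ F x a) (Ua : U a) (a⊏b : _<_ F a b) (x⊏c : _<_ F x c) (Vc : V c)
  where
  open Poset F renaming (refl to ≤-refl; trans to ≤-trans)
  open Kripke F
  open Classical em F
  open Evaluation Scott
  open FinRootedPoset Scott using (leq)

  Maximal : Carrier → Set L
  Maximal w = ¬ ∃ (w ⊏_)

  maximal-point-above : ∀ z → ∃ λ w → z ≤ w × Maximal w
  maximal-point-above z =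
    let w , z≤w , _ , maximal = maximal-above (λ _ → Lift L ⊤) n (height⇒bounded height z) (lift tt)
    in  w , z≤w , λ (w′ , w⊏w′) → maximal w′ w⊏w′ (lift tt)

  data Class (z : Carrier) : Fin 4 → Set L where
    below  : z ≤ x → Class z #0
    middle : ¬ z ≤ x → U z → ¬ Maximal z → Class z #1
    top    : ¬ z ≤ x → U z → Maximal z → Class z #2
    side   : ¬ z ≤ x → ¬ U z → Class z #3

  classify : ∀ z → ∃ (Class z)
  classify z with z ≤? x | em {U z} | em {Maximal z}
  ... | yes z≤x | _       | _        = #0 , below z≤x
  ... | no  z≰x | yes Uz  | no  ¬max = #1 , middle z≰x Uz ¬max
  ... | no  z≰x | yes Uz  | yes max  = #2 , top z≰x Uz max
  ... | no  z≰x | no  ¬Uz | _        = #3 , side z≰x ¬Uz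

  class-unique : ∀ {z i j} → Class z i → Class z j → i ≡ j
  class-unique (below _)       (below _)       = refl
  class-unique (below p)       (middle ¬p _ _) = ⊥-elim (¬p p)
  class-unique (below p)       (top ¬p _ _)    = ⊥-elim (¬p p)
  class-unique (below p)       (side ¬p _)     = ⊥-elim (¬p p)
  class-unique (middle ¬p _ _) (below p)       = ⊥-elim (¬p p)
  class-unique (middle _ _ _)  (middle _ _ _)  = refl
  class-unique (middle _ _ ¬p) (top _ _ p)     = ⊥-elim (¬p p)
  class-unique (middle _ p _)  (side _ ¬p)     = ⊥-elim (¬p p)
  class-unique (top ¬p _ _)    (below p)       = ⊥-elim (¬p p)
  class-unique (top _ _ p)     (middle _ _ ¬p) = ⊥-elim (¬p p)
  class-unique (top _ _ _)     (top _ _ _)     = refl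
  class-unique (top _ p _)     (side _ ¬p)     = ⊥-elim (¬p p)
  class-unique (side ¬p _)     (below p)       = ⊥-elim (¬p p)
  class-unique (side _ ¬p)     (middle _ p _)  = ⊥-elim (¬p p)
  class-unique (side _ ¬p)     (top _ p _)     = ⊥-elim (¬p p)
  class-unique (side _ _)      (side _ _)      = refl

  f : Carrier → Fin 4
  f = proj₁ ∘ classify

  f-class : ∀ {z j} → Class z j → f z ≡ j
  f-class {z} = class-unique (proj₂ (classify z))

  f-mono : ∀ {z z′} → x ≤ z → z ≤ z′ → T (leq (f z) (f z′))
  f-mono {z} {z′} x≤z z≤z′ = go (proj₂ (classify z)) (proj₂ (classify z′))
    where
    side-stays : ¬ z ≤ x → ¬ U z → ¬ z′ ≤ x → ¬ U z′
    side-stays z≰x ¬Uz z′≰x Uz′ =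
      Sum.[ ¬Uz , (λ Vz → disjoint z′ (≤∧≱⇒⊏ (≤-trans x≤z z≤z′) z′≰x) Uz′ (V-up z≤z′ Vz)) ]
        (cover z (≤∧≱⇒⊏ x≤z z≰x))
    go : ∀ {i j} → Class z i → Class z′ j → T (leq i j)
    go (below _)        _                   = _
    go (middle z≰x _ _) (below z′≤x)        = z≰x (≤-trans z≤z′ z′≤x)
    go (middle _ _ _)   (middle _ _ _)      = _
    go (middle _ _ _)   (top _ _ _)         = _
    go (middle _ Uz _)  (side _ ¬Uz′)       = ¬Uz′ (U-up z≤z′ Uz)
    go (top z≰x _ _)    (below z′≤x)        = z≰x (≤-trans z≤z′ z′≤x)
    go (top _ _ max)    (middle _ _ ¬max′)  = ¬max′ λ (w , z′⊏w) → max (w , ≤-⊏-trans z≤z′ z′⊏w)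
    go (top _ _ _)      (top _ _ _)         = _
    go (top _ Uz _)     (side _ ¬Uz′)       = ¬Uz′ (U-up z≤z′ Uz)
    go (side z≰x _)     (below z′≤x)        = z≰x (≤-trans z≤z′ z′≤x)
    go (side z≰x ¬Uz)   (middle z′≰x Uz′ _) = side-stays z≰x ¬Uz z′≰x Uz′
    go (side z≰x ¬Uz)   (top z′≰x Uz′ _)    = side-stays z≰x ¬Uz z′≰x Uz′
    go (side _ _)       (side _ _)          = _

  top-above : ∀ {z} → ¬ z ≤ x → U z → ∃ λ w → z ≤ w × f w ≡ #2
  top-above {z} z≰x Uz =
    let w , z≤w , max = maximal-point-above z
    in  w , z≤w , f-class (top (λ w≤x → z≰x (≤-trans z≤w w≤x)) (U-up z≤w Uz) max)

  f-back : ∀ {z} j → x ≤ z → T (leq (f z) j) → ∃ λ z′ → z ≤ z′ × f z′ ≡ j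
  f-back {z} j x≤z fz≤j with classify z
  ... | suc (suc i) , z∈i = z , ≤-refl , ≡.trans (f-class z∈i) (scott-upper-maximal i j fz≤j)
  ... | #1 , z∈1@(middle z≰x Uz _) with j
  ...   | #1 = z , ≤-refl , f-class z∈1
  ...   | #2 = top-above z≰x Uz
  f-back {z} j x≤z fz≤j | #0 , z∈0@(below z≤x) with j
  ...   | #0 = z , ≤-refl , f-class z∈0
  ...   | #1 = a , ≤-trans z≤x (proj₁ x⊏a) , f-class (middle (⊏⇒≱ x⊏a) Ua λ max → max (b , a⊏b))
  ...   | #2 = let w , a≤w , fw≡2 = top-above (⊏⇒≱ x⊏a) Ua
               in  w , ≤-trans z≤x (≤-trans (proj₁ x⊏a) a≤w) , fw≡2
  ...   | #3 = c , ≤-trans z≤x (proj₁ x⊏c) , f-class (side (⊏⇒≱ x⊏c) λ Uc → disjoint c x⊏c Uc Vc)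

  scott-refuted : ¬ Valid F (χ Scott)
  scott-refuted valid = subst (T ∘ eval (χ Scott)) (f-class (below ≤-refl))
    (PMorphism.valid⇒eval F _ x f f-mono f-back (χ Scott) valid)

-- In χ Fork₃ and χ Scott the variable of an upset U is Jankov.code U, element i having weight 2^i.
-- Fork₃: 2, 4, 8 are the three leaves, 6, 10, 12 the pairs of leaves, 14 = Q ∖ {root}, 0 = ∅.
-- Scott (r, a, b, c = 0, 1, 2, 3): 4 = {b}, 6 = {a, b}, 8 = {c}, 12 = {b, c}, 14 = Q ∖ {r}, 0 = ∅.
module Soundness {c ℓ₁ ℓ₂} (em : ExcludedMiddle (c ⊔ ℓ₁ ⊔ ℓ₂)) (F : Poset c ℓ₁ ℓ₂)
  {n} (height : HeightAtMost F n) where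
  open Poset F renaming (refl to ≤-refl; trans to ≤-trans)
  open Kripke F
  open Classical em F

  module Counterexample (Q : FinRootedPoset) (V : Valuation F) {y₀}
    (conds : Forces F V y₀ (⋀ (Jankov.conditions Q))) (¬p₁₄ : ¬ proj₁ V 14 y₀) where

    p : ℕ → Carrier → Set L
    p = proj₁ V

    p-up : ∀ i → UpClosed F (p i)
    p-up = proj₂ V

    maximal : ∃ λ y → y₀ ≤ y × ¬ p 14 y × (∀ w → y ⊏ w → ¬ ¬ p 14 w)
    maximal = maximal-above (¬_ ∘ p 14) n (height⇒bounded height y₀) ¬p₁₄

    y : Carrier
    y = proj₁ maximal

    y₀≤y : y₀ ≤ y
    y₀≤y = proj₁ (proj₂ maximal)

    ¬p₁₄y : ¬ p 14 y
    ¬p₁₄y = proj₁ (proj₂ (proj₂ maximal))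

    ⊐y⇒p₁₄ : ∀ {w} → y ⊏ w → p 14 w
    ⊐y⇒p₁₄ {w} y⊏w = decidable-stable em (proj₂ (proj₂ (proj₂ maximal)) w y⊏w)

    -- For closed Q, φ and ψ the hidden membership proof normalises to tt and is inferred.
    condition : ∀ φ ψ {w} → y ≤ w → {T (any ((φ ⇔' ψ) ==_) (Jankov.conditions Q))} →
      Forces F V w φ ⇔ Forces F V w ψ
    condition φ ψ y≤w {φ⇔ψ∈} =
      let φ⇒ψ , ψ⇒φ = forces-⋀ V (φ ⇔' ψ) (Jankov.conditions Q) φ⇔ψ∈
                        (forces-mono V (⋀ (Jankov.conditions Q)) (≤-trans y₀≤y y≤w) conds)
      in  mk⇔ (φ⇒ψ _ ≤-refl) (ψ⇒φ _ ≤-refl)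

    p∅ : Formula
    p∅ = Jankov.p Q (Jankov.empty Q)

    p∅-unforced : ∀ {w} → y ≤ w → ¬ Forces F V w p∅
    p∅-unforced y≤w =
      lower ∘ proj₁ (proj₁ (forces-mono V (⋀ (Jankov.conditions Q)) (≤-trans y₀≤y y≤w) conds)) _ ≤-refl

    disjoint : ∀ i j {w} → y ≤ w → {T (any ((p∅ ⇔' (var i ∧' var j)) ==_) (Jankov.conditions Q))} →
      p i w → p j w → ⊥
    disjoint i j y≤w {i∧j∈} pi pj =
      p∅-unforced y≤w (from (condition p∅ (var i ∧' var j) y≤w {i∧j∈}) (pi , pj))

    Witness : ℕ → ℕ → Set L
    Witness i j = ∃ λ w → y ⊏ w × p i w × ¬ p j w

    witness : ∀ k i j → (p k y → p 14 y) → (∀ {w} → y ≤ w → p i w → p 14 w) →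
      {T (any ((var k ⇔' (var i ⇒ var j)) ==_) (Jankov.conditions Q))} → Witness i j
    witness k i j k⇒14 i⇒14 {k⇔i⇒j∈} =
      let w , y≤w , pi , ¬pj = counterexample (p i) (p j)
            (¬p₁₄y ∘ k⇒14 ∘ from (condition (var k) (var i ⇒ var j) ≤-refl {k⇔i⇒j∈}))
      in  w , ≤-∉⇒⊏ (p-up 14) ¬p₁₄y y≤w (i⇒14 y≤w pi) , pi , ¬pj

  module ForkArgument
    (card : ∀ x → DepthIsOne F x → CardAtMost2 F (⇑ F x))
    (conn : ∀ x → DepthAboveOne F x → Connected F (⇑ F x))
    (V : Valuation F) {y₀} (conds : Forces F V y₀ (⋀ (Jankov.conditions Fork₃)))
    (¬p₁₄ : ¬ proj₁ V 14 y₀)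
    where
    open Counterexample Fork₃ V conds ¬p₁₄

    leaves⇒p₁₄ : ∀ {w} → y ≤ w → p 2 w ⊎ p 4 w ⊎ p 8 w → p 14 w
    leaves⇒p₁₄ y≤w = from (condition (var 14) (var 6 ∨' var 8) y≤w)
                   ∘ Sum.map₁ (from (condition (var 6) (var 2 ∨' var 4) y≤w))
                   ∘ Sum.assocˡ

    p₁₄⇒leaves : ∀ {w} → y ≤ w → p 14 w → p 2 w ⊎ p 4 w ⊎ p 8 w
    p₁₄⇒leaves y≤w = Sum.assocʳ
                   ∘ Sum.map₁ (to (condition (var 6) (var 2 ∨' var 4) y≤w))
                   ∘ to (condition (var 14) (var 6 ∨' var 8) y≤w)

    leaf₂ : Witness 2 12
    leaf₂ = witness 12 2 12
      (leaves⇒p₁₄ ≤-refl ∘ inj₂ ∘ to (condition (var 12) (var 4 ∨' var 8) ≤-refl))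
      (λ y≤w → leaves⇒p₁₄ y≤w ∘ inj₁)

    leaf₄ : Witness 4 10
    leaf₄ = witness 10 4 10
      (leaves⇒p₁₄ ≤-refl ∘ Sum.map₂ inj₂ ∘ to (condition (var 10) (var 2 ∨' var 8) ≤-refl))
      (λ y≤w → leaves⇒p₁₄ y≤w ∘ inj₂ ∘ inj₁)

    leaf₈ : Witness 8 6
    leaf₈ = witness 6 8 6
      (leaves⇒p₁₄ ≤-refl ∘ Sum.map₂ inj₁ ∘ to (condition (var 6) (var 2 ∨' var 4) ≤-refl))
      (λ y≤w → leaves⇒p₁₄ y≤w ∘ inj₂ ∘ inj₂)

    absurd : Witness 2 12 → Witness 4 10 → Witness 8 6 → ⊥
    absurd (w₁ , y⊏w₁ , p₂ , _) (w₂ , y⊏w₂ , p₄ , _) (w₃ , y⊏w₃ , p₈ , _) with em {DepthAtMost F y 1}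
    ... | yes depth≤1 with card y (depth≤1 , chain⇒¬depth≤ (y⊏w₁ ◅ ε)) w₁ w₂ w₃ y⊏w₁ y⊏w₂ y⊏w₃
    ...   | inj₁ w₁≈w₂        = disjoint 2 4 (proj₁ y⊏w₂) (p-up 2 (reflexive w₁≈w₂) p₂) p₄
    ...   | inj₂ (inj₁ w₁≈w₃) = disjoint 2 8 (proj₁ y⊏w₃) (p-up 2 (reflexive w₁≈w₃) p₂) p₈
    ...   | inj₂ (inj₂ w₂≈w₃) = disjoint 4 8 (proj₁ y⊏w₃) (p-up 4 (reflexive w₂≈w₃) p₄) p₈
    absurd (w₁ , y⊏w₁ , p₂ , _) (w₂ , y⊏w₂ , p₄ , _) _ | no ¬depth≤1 =
      conn y ¬depth≤1 (p 2) (λ w → p 4 w ⊎ p 8 w) (p-up 2) (λ w≤w′ → Sum.map (p-up 4 w≤w′) (p-up 8 w≤w′))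
        (λ w y⊏w → p₁₄⇒leaves (proj₁ y⊏w) (⊐y⇒p₁₄ y⊏w))
        (λ w y⊏w p₂ → Sum.[ disjoint 2 4 (proj₁ y⊏w) p₂ , disjoint 2 8 (proj₁ y⊏w) p₂ ])
        ((w₁ , y⊏w₁ , p₂) , (w₂ , y⊏w₂ , inj₁ p₄))

  fork-valid : (∀ x → DepthIsOne F x → CardAtMost2 F (⇑ F x)) →
    (∀ x → DepthAboveOne F x → Connected F (⇑ F x)) → Valid F (χ Fork₃)
  fork-valid card conn V _ _ _ conds = decidable-stable em λ ¬p₁₄ →
    let open ForkArgument card conn V conds ¬p₁₄ in absurd leaf₂ leaf₄ leaf₈

  module ScottArgument
    (conn : ∀ x → DepthAboveOne F x → Connected F (⇑ F x))
    (V : Valuation F) {y₀} (conds : Forces F V y₀ (⋀ (Jankov.conditions Scott)))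
    (¬p₁₄ : ¬ proj₁ V 14 y₀)
    where
    open Counterexample Scott V conds ¬p₁₄

    p₁₄⇔p₆∨p₈ : ∀ {w} → y ≤ w → p 14 w ⇔ (p 6 w ⊎ p 8 w)
    p₁₄⇔p₆∨p₈ y≤w = condition (var 14) (var 6 ∨' var 8) y≤w

    c-witness : Witness 8 6
    c-witness = witness 6 8 6 (from (p₁₄⇔p₆∨p₈ ≤-refl) ∘ inj₁) (λ y≤w → from (p₁₄⇔p₆∨p₈ y≤w) ∘ inj₂)

    a-witness : Witness 6 4
    a-witness = witness 12 6 4
      (from (condition (var 14) (var 12 ∨' var 6) ≤-refl) ∘ inj₁) (λ y≤w → from (p₁₄⇔p₆∨p₈ y≤w) ∘ inj₁)

    b-above : ∀ {a} → y ≤ a → p 6 a → ¬ p 4 a → ∃ λ b → a ⊏ b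
    b-above {a} y≤a p₆ ¬p₄ =
      let b , a≤b , p₄ , _ = counterexample (p 4) (p 0)
            (disjoint 6 8 y≤a p₆ ∘ from (condition (var 8) (var 4 ⇒ var 0) y≤a))
      in  b , ≤-∉⇒⊏ (p-up 4) ¬p₄ a≤b p₄

    absurd : Witness 6 4 → Witness 8 6 → ⊥
    absurd (a , y⊏a , p₆ , ¬p₄) (c , y⊏c , p₈ , _) =
      conn y (chain⇒¬depth≤ (y⊏a ◅ proj₂ (b-above (proj₁ y⊏a) p₆ ¬p₄) ◅ ε))
        (p 6) (p 8) (p-up 6) (p-up 8)
        (λ w y⊏w → to (p₁₄⇔p₆∨p₈ (proj₁ y⊏w)) (⊐y⇒p₁₄ y⊏w))
        (λ w y⊏w → disjoint 6 8 (proj₁ y⊏w))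
        ((a , y⊏a , p₆) , (c , y⊏c , p₈))

  scott-valid : (∀ x → DepthAboveOne F x → Connected F (⇑ F x)) → Valid F (χ Scott)
  scott-valid conn V _ _ _ conds = decidable-stable em λ ¬p₁₄ →
    let open ScottArgument conn V conds ¬p₁₄ in absurd a-witness c-witness

module Characterisation {c ℓ₁ ℓ₂} (em : ExcludedMiddle (c ⊔ ℓ₁ ⊔ ℓ₂)) (F : Poset c ℓ₁ ℓ₂) (n : ℕ) where
  open Kripke F
  open Classical em F

  PL-valid⇒height : ValidLogic F (PL n) → HeightAtMost F n
  PL-valid⇒height valid = bd-valid⇒height (valid (bd n) (hyp (inj₁ (bd∈BD (lowerEM _ em) n))))

  PL-valid⇒card : ValidLogic F (PL n) → ∀ x → DepthIsOne F x → CardAtMost2 F (⇑ F x)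
  PL-valid⇒card valid x (depth≤1 , _) y₁ y₂ y₃ x⊏y₁ x⊏y₂ x⊏y₃ =
    decidable-stable (lowerEM (c ⊔ ℓ₂) em) λ ¬≈ →
      ForkRefutation.fork-refuted em F x y₁ y₂ y₃ depth≤1 x⊏y₁ x⊏y₂ x⊏y₃
        (¬≈ ∘ inj₁) (¬≈ ∘ inj₂ ∘ inj₁) (¬≈ ∘ inj₂ ∘ inj₂)
        (valid (χ Fork₃) (hyp (inj₂ (inj₁ (lift refl)))))

  PL-valid⇒connected : ValidLogic F (PL n) → ∀ x → DepthAboveOne F x → Connected F (⇑ F x)
  PL-valid⇒connected valid x ¬depth≤1 U V U-up V-up cover disjoint ((u , x⊏u , Uu) , (v , x⊏v , Vv))
    with ¬depth≤1⇒⊏⊏ ¬depth≤1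
  ... | y , z , x⊏y , y⊏z = Sum.[
      (λ Uy → scott-refuted U V U-up V-up cover disjoint y z v x⊏y Uy y⊏z x⊏v Vv χScott-valid) ,
      (λ Vy → scott-refuted V U V-up U-up (λ w → Sum.swap ∘ cover w) (λ w → flip ∘ disjoint w)
                            y z u x⊏y Vy y⊏z x⊏u Uu χScott-valid)
    ] (cover y x⊏y)
    where
    open ScottRefutation em F (PL-valid⇒height valid) x using (scott-refuted)
    χScott-valid : Valid F (χ Scott)
    χScott-valid = valid (χ Scott) (hyp (inj₂ (inj₂ (lift refl))))

  conditions⇒PL-valid : HeightAtMost F n →
    (∀ x → DepthIsOne F x → CardAtMost2 F (⇑ F x)) →
    (∀ x → DepthAboveOne F x → Connected F (⇑ F x)) → ValidLogic F (PL n)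
  conditions⇒PL-valid height card conn = smallest-valid generators-valid
    where
    generators-valid : ∀ φ → PLGen n φ → Valid F φ
    generators-valid φ (inj₁ bdφ) V x             = Unravelling.bd-sound em F height φ V x bdφ
    generators-valid _ (inj₂ (inj₁ (lift refl))) = Soundness.fork-valid em F height card conn
    generators-valid _ (inj₂ (inj₂ (lift refl))) = Soundness.scott-valid em F height conn

lemma7p3 : ∀ {c ℓ₁ ℓ₂} → ExcludedMiddle (lsuc (c ⊔ ℓ₁ ⊔ ℓ₂)) →
    (F : Poset c ℓ₁ ℓ₂) (n : ℕ) →
    ValidLogic F (PL n) ⇔
      ( HeightAtMost F n
      × (∀ x → DepthIsOne F x → CardAtMost2 F (⇑ F x))
      × (∀ x → DepthAboveOne F x → Connected F (⇑ F x)) )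
lemma7p3 {c} {ℓ₁} {ℓ₂} lem F n = mk⇔
  (λ valid → PL-valid⇒height valid , PL-valid⇒card valid , PL-valid⇒connected valid)
  (λ (height , card , conn) → conditions⇒PL-valid height card conn)
  where open Characterisation (lowerEM (lsuc (c ⊔ ℓ₁ ⊔ ℓ₂)) lem) F n
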